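{- Let $\mathcal I,\mathcal J$ be finite categories. Any coherent functor $M:\mathbf{Set}_{\mathrm f}[\mathcal J]\to\mathbf{Set}_{\mathrm f}[\mathcal I]$ preserves all finite colimits.
   Context: $\mathbf{Set}_{\mathrm f}[\mathcal I]$ denotes the functor category $[\mathcal I,\mathbf{Set}_{\mathrm f}]$, a pretopos; a coherent functor preserves finite limits, images and finite unions of subobjects. -}

module Defs where

open import Level using (0ℓ)
open import Data.Nat using (ℕ)
open import Data.Fin using (Fin)
open import Data.Product using (Σ; _×_; _,_)
open import Relation.Binary using (Rel; IsEquivalence)
open import Relation.Binary.PropositionalEquality
  using (_≡_; refl; sym; trans; cong; cong₂; isEquivalence)

record Category : Set₁ where
  infixr 9 _∘_
  infix 4 _≈_
  field
    Obj : Set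
    Hom : Obj → Obj → Set
    _≈_ : ∀ {A B} → Rel (Hom A B) 0ℓ
    ≈-equiv : ∀ {A B} → IsEquivalence (_≈_ {A} {B})
    id : ∀ {A} → Hom A A
    _∘_ : ∀ {A B C} → Hom B C → Hom A B → Hom A C
    identityˡ : ∀ {A B} (f : Hom A B) → id ∘ f ≈ f
    identityʳ : ∀ {A B} (f : Hom A B) → f ∘ id ≈ f
    assoc : ∀ {A B C D} (h : Hom C D) (g : Hom B C) (f : Hom A B) →
            (h ∘ g) ∘ f ≈ h ∘ (g ∘ f)
    ∘-resp-≈ : ∀ {A B C} {g g' : Hom B C} {f f' : Hom A B} →
               g ≈ g' → f ≈ f' → g ∘ f ≈ g' ∘ f'

  ≈-refl : ∀ {A B} {f : Hom A B} → f ≈ f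
  ≈-refl = IsEquivalence.refl ≈-equiv
  ≈-sym : ∀ {A B} {f g : Hom A B} → f ≈ g → g ≈ f
  ≈-sym = IsEquivalence.sym ≈-equiv
  ≈-trans : ∀ {A B} {f g h : Hom A B} → f ≈ g → g ≈ h → f ≈ h
  ≈-trans = IsEquivalence.trans ≈-equiv

open Category

record FinCat : Set where
  field
    nObj : ℕ
    nHom : Fin nObj → Fin nObj → ℕ
    fid : ∀ {a} → Fin (nHom a a)
    fcomp : ∀ {a b c} → Fin (nHom b c) → Fin (nHom a b) → Fin (nHom a c)
    fidˡ : ∀ {a b} (f : Fin (nHom a b)) → fcomp fid f ≡ f
    fidʳ : ∀ {a b} (f : Fin (nHom a b)) → fcomp f fid ≡ f
    fassoc : ∀ {a b c d} (h : Fin (nHom c d)) (g : Fin (nHom b c))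
             (f : Fin (nHom a b)) →
             fcomp (fcomp h g) f ≡ fcomp h (fcomp g f)

FC : FinCat → Category
FC D = record
  { Obj = Fin nObj
  ; Hom = λ a b → Fin (nHom a b)
  ; _≈_ = _≡_
  ; ≈-equiv = isEquivalence
  ; id = fid
  ; _∘_ = fcomp
  ; identityˡ = fidˡ
  ; identityʳ = fidʳ
  ; assoc = fassoc
  ; ∘-resp-≈ = λ p q → cong₂ fcomp p q
  }
  where open FinCat D

record Functor (C D : Category) : Set where
  field
    F₀ : Obj C → Obj D
    F₁ : ∀ {A B} → Hom C A B → Hom D (F₀ A) (F₀ B)
    F-resp-≈ : ∀ {A B} {f g : Hom C A B} → _≈_ C f g → _≈_ D (F₁ f) (F₁ g)
    F-id : ∀ {A} → _≈_ D (F₁ (id C {A})) (id D)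
    F-∘ : ∀ {A B E} (g : Hom C B E) (f : Hom C A B) →
          _≈_ D (F₁ (_∘_ C g f)) (_∘_ D (F₁ g) (F₁ f))

open Functor

_∘F_ : ∀ {B C D} → Functor C D → Functor B C → Functor B D
_∘F_ {B} {C} {D} G F = record
  { F₀ = λ A → F₀ G (F₀ F A)
  ; F₁ = λ f → F₁ G (F₁ F f)
  ; F-resp-≈ = λ p → F-resp-≈ G (F-resp-≈ F p)
  ; F-id = ≈-trans D (F-resp-≈ G (F-id F)) (F-id G)
  ; F-∘ = λ g f → ≈-trans D (F-resp-≈ G (F-∘ F g f)) (F-∘ G (F₁ F g) (F₁ F f))
  }

-- The functor category Set_f[I] = [I, Set_f], for a finite category I.
-- Set_f is represented by its skeleton: the finite sets Fin n.

record FinSetFunctor (I : FinCat) : Set where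
  open FinCat I
  field
    S₀ : Fin nObj → ℕ
    S₁ : ∀ {a b} → Fin (nHom a b) → Fin (S₀ a) → Fin (S₀ b)
    S-id : ∀ {a} (x : Fin (S₀ a)) → S₁ (fid {a}) x ≡ x
    S-∘ : ∀ {a b c} (g : Fin (nHom b c)) (f : Fin (nHom a b)) (x : Fin (S₀ a)) →
          S₁ (fcomp g f) x ≡ S₁ g (S₁ f x)

open FinSetFunctor

record NatTrans {I : FinCat} (F G : FinSetFunctor I) : Set where
  open FinCat I
  field
    η : ∀ a → Fin (S₀ F a) → Fin (S₀ G a)
    natural : ∀ {a b} (f : Fin (nHom a b)) (x : Fin (S₀ F a)) →
              η b (S₁ F f x) ≡ S₁ G f (η a x)

open NatTrans

SetF[_] : FinCat → Category
SetF[ I ] = record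
  { Obj = FinSetFunctor I
  ; Hom = NatTrans
  ; _≈_ = λ α β → ∀ a x → η α a x ≡ η β a x
  ; ≈-equiv = record
      { refl = λ a x → refl
      ; sym = λ p a x → sym (p a x)
      ; trans = λ p q a x → trans (p a x) (q a x) }
  ; id = record { η = λ a x → x ; natural = λ f x → refl }
  ; _∘_ = λ β α → record
      { η = λ a x → η β a (η α a x)
      ; natural = λ f x → trans (cong (η β _) (natural α f x)) (natural β f (η α _ x)) }
  ; identityˡ = λ f a x → refl
  ; identityʳ = λ f a x → refl
  ; assoc = λ h g f a x → refl
  ; ∘-resp-≈ = λ {_} {_} {_} {g} {g'} {f} {f'} p q a x →
      trans (cong (η g a) (q a x)) (p a (η f' a x))
  }

module _ {C : Category} {D : FinCat} where
  open Category C using () renaming (Hom to HomC; _∘_ to _∘C_; _≈_ to _≈C_)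
  open FinCat D

  record Cone (F : Functor (FC D) C) : Set where
    field
      apex : Obj C
      leg : ∀ a → HomC apex (F₀ F a)
      commute : ∀ {a b} (f : Fin (nHom a b)) → (F₁ F f ∘C leg a) ≈C leg b

  record Cocone (F : Functor (FC D) C) : Set where
    field
      coapex : Obj C
      coleg : ∀ a → HomC (F₀ F a) coapex
      cocommute : ∀ {a b} (f : Fin (nHom a b)) → (coleg b ∘C F₁ F f) ≈C coleg a

  open Cone
  open Cocone

  IsLimit : {F : Functor (FC D) C} → Cone F → Set
  IsLimit {F} c = (c' : Cone F) →
    Σ (HomC (apex c') (apex c)) λ u →
      (∀ a → (leg c a ∘C u) ≈C leg c' a) ×
      (∀ (u' : HomC (apex c') (apex c)) →
         (∀ a → (leg c a ∘C u') ≈C leg c' a) → u' ≈C u)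

  IsColimit : {F : Functor (FC D) C} → Cocone F → Set
  IsColimit {F} c = (c' : Cocone F) →
    Σ (HomC (coapex c) (coapex c')) λ u →
      (∀ a → (u ∘C coleg c a) ≈C coleg c' a) ×
      (∀ (u' : HomC (coapex c) (coapex c')) →
         (∀ a → (u' ∘C coleg c a) ≈C coleg c' a) → u' ≈C u)

module _ {C E : Category} {D : FinCat} (M : Functor C E) where
  open Cone
  open Cocone

  mapCone : {F : Functor (FC D) C} → Cone F → Cone (M ∘F F)
  mapCone {F} c = record
    { apex = F₀ M (apex c)
    ; leg = λ a → F₁ M (leg c a)
    ; commute = λ f → ≈-trans E (≈-sym E (F-∘ M (F₁ F f) (leg c _)))
                                (F-resp-≈ M (commute c f))
    }

  mapCocone : {F : Functor (FC D) C} → Cocone F → Cocone (M ∘F F)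
  mapCocone {F} c = record
    { coapex = F₀ M (coapex c)
    ; coleg = λ a → F₁ M (coleg c a)
    ; cocommute = λ f → ≈-trans E (≈-sym E (F-∘ M (coleg c _) (F₁ F f)))
                                  (F-resp-≈ M (cocommute c f))
    }

PreservesFiniteLimits : ∀ {C E} → Functor C E → Set
PreservesFiniteLimits {C} M =
  (D : FinCat) (F : Functor (FC D) C) (c : Cone F) →
  IsLimit c → IsLimit (mapCone M c)

PreservesFiniteColimits : ∀ {C E} → Functor C E → Set
PreservesFiniteColimits {C} M =
  (D : FinCat) (F : Functor (FC D) C) (c : Cocone F) →
  IsColimit c → IsColimit (mapCocone M c)

module _ (C : Category) where
  open Category C using () renaming (Hom to HomC; _∘_ to _∘C_; _≈_ to _≈C_)

  Mono : ∀ {A B} → HomC A B → Set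
  Mono {A} m = ∀ {X} (g h : HomC X A) → (m ∘C g) ≈C (m ∘C h) → g ≈C h

  IsImage : ∀ {A B I} → HomC A B → HomC A I → HomC I B → Set
  IsImage {A} {B} {I} f e m =
    Mono m × (f ≈C (m ∘C e)) ×
    (∀ {I'} (e' : HomC A I') (m' : HomC I' B) → Mono m' → f ≈C (m' ∘C e') →
       Σ (HomC I I') λ k → m ≈C (m' ∘C k))

  IsUnion : ∀ {B} (k : ℕ) (S : Fin k → Obj C) → (∀ i → HomC (S i) B) →
            ∀ {U} → HomC U B → Set
  IsUnion {B} k S ms {U} u =
    Mono u × (∀ i → Σ (HomC (S i) U) λ t → ms i ≈C (u ∘C t)) ×
    (∀ {V} (v : HomC V B) → Mono v →
       (∀ i → Σ (HomC (S i) V) λ t → ms i ≈C (v ∘C t)) →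
       Σ (HomC U V) λ t → u ≈C (v ∘C t))

PreservesImages : ∀ {C E} → Functor C E → Set
PreservesImages {C} {E} M =
  ∀ {A B I} (f : Hom C A B) (e : Hom C A I) (m : Hom C I B) →
  IsImage C f e m → IsImage E (F₁ M f) (F₁ M e) (F₁ M m)

PreservesFiniteUnions : ∀ {C E} → Functor C E → Set
PreservesFiniteUnions {C} {E} M =
  ∀ {B} (k : ℕ) (S : Fin k → Obj C) (ms : ∀ i → Hom C (S i) B) →
  (∀ i → Mono C (ms i)) →
  ∀ {U} (u : Hom C U B) → IsUnion C k S ms u →
  IsUnion E k (λ i → F₀ M (S i)) (λ i → F₁ M (ms i)) (F₁ M u)

IsCoherent : ∀ {C E} → Functor C E → Set
IsCoherent M = PreservesFiniteLimits M × PreservesImages M × PreservesFiniteUnions M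

module Submission where

-- In Set_f[I] a cocone is a colimit as soon as its legs are jointly surjective and every
-- other cocone identifies whatever those legs identify.  Let L be a colimit of
-- F : D → Set_f[J].  Its legs are jointly surjective, i.e. L is the union of their images,
-- and M preserves unions and images.  The legs F a → L ← F b identify x and y exactly
-- when a zigzag of arrows of D joins them; by finiteness one length of zigzag suffices,
-- so this kernel pair is obtained from the graphs of the maps F f by finitely many
-- compositions of relations and finite unions, each such relation being covered by
-- images of spans.  M preserves the kernel pair (a pullback), the images and the unions,
-- so by induction along the construction every cocone under M ∘ F identifies the two
-- ends of every element of M applied to the kernel pair.

open import Defs

open import Data.Bool using (Bool; true; false; T; if_then_else_)
open import Data.Bool.Properties using (T-irrelevant)
open import Data.Empty using (⊥-elim)
open import Data.Fin using (Fin; zero; suc)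
open import Data.Fin.Properties using (+↔⊎; 0↔⊥; 1↔⊤; any?; all?; ¬∀⟶∃¬; _≟_)
open import Data.Nat using (ℕ; zero; suc; _+_; _≤_; _<_; z≤n; s≤s)
open import Data.Nat.Properties using (≤-refl; ≤-trans; <-irrefl; m≤n⇒m≤1+n; m<n⇒m<1+n; m≤m+n; m≤n+m)
open import Data.Product using (Σ; _×_; _,_; proj₁; proj₂)
open import Data.Product.Function.Dependent.Propositional using (Σ-↔)
open import Data.Sum using (_⊎_; inj₁; inj₂)
open import Data.Sum.Function.Propositional using (_⊎-↔_)
open import Data.Unit using (⊤; tt)
open import Function using (_∘_)
open import Function.Bundles using (_↔_; _⇔_; Inverse; mk↔ₛ′; mk⇔)
open import Function.Definitions using (Injective)
open import Function.Properties.Inverse using (↔-refl; ↔-sym; ↔-trans)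
open import Relation.Binary.PropositionalEquality
  using (_≡_; refl; sym; trans; cong; cong₂; subst; module ≡-Reasoning)
open import Relation.Nullary using (Dec; yes; no; ¬_)
open import Relation.Nullary.Decidable
  using (True; isYes; isYes≗does; does-⇔; toWitness; fromWitness; T?; _→-dec_; _×-dec_; _⊎-dec_)

open FinSetFunctor
open NatTrans

record Finite (A : Set) : Set where
  field
    size : ℕ
    enumeration : A ↔ Fin size

  open Inverse enumeration public
    using ()
    renaming (to to encode; from to decode;
              strictlyInverseʳ to decode-encode; strictlyInverseˡ to encode-decode)

  decode-injective : ∀ {i i′} → decode i ≡ decode i′ → i ≡ i′
  decode-injective {i} {i′} eq =
    trans (sym (encode-decode i)) (trans (cong encode eq) (encode-decode i′))

open Finite using (size; enumeration)

finite-Fin : ∀ n → Finite (Fin n)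
finite-Fin n = record { size = n ; enumeration = ↔-refl }

opaque
  finite-T : ∀ b → Finite (T b)
  finite-T true = record { size = 1 ; enumeration = ↔-sym 1↔⊤ }
  finite-T false = record { size = 0 ; enumeration = ↔-sym 0↔⊥ }

  finite-⊎ : ∀ {A B} → Finite A → Finite B → Finite (A ⊎ B)
  finite-⊎ a b = record
    { size = size a + size b
    ; enumeration = ↔-trans (enumeration a ⊎-↔ enumeration b) (↔-sym +↔⊎) }

  Σ-Fin-suc↔ : ∀ {n} (B : Fin (suc n) → Set) → Σ (Fin (suc n)) B ↔ (B zero ⊎ Σ (Fin n) (B ∘ suc))
  Σ-Fin-suc↔ B = mk↔ₛ′ to from to∘from from∘to
    where
    to : Σ _ B → B zero ⊎ Σ _ (B ∘ suc)
    to (zero , b) = inj₁ b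
    to (suc i , b) = inj₂ (i , b)
    from : B zero ⊎ Σ _ (B ∘ suc) → Σ _ B
    from (inj₁ b) = zero , b
    from (inj₂ (i , b)) = suc i , b
    to∘from : ∀ s → to (from s) ≡ s
    to∘from (inj₁ b) = refl
    to∘from (inj₂ (i , b)) = refl
    from∘to : ∀ s → from (to s) ≡ s
    from∘to (zero , b) = refl
    from∘to (suc i , b) = refl

  finite-Σ-Fin : ∀ {n} {B : Fin n → Set} → (∀ i → Finite (B i)) → Finite (Σ (Fin n) B)
  finite-Σ-Fin {zero} _ = record { size = 0 ; enumeration = mk↔ₛ′ (λ ()) (λ ()) (λ ()) (λ ()) }
  finite-Σ-Fin {suc n} {B} fin = record
    { size = size rest
    ; enumeration = ↔-trans (Σ-Fin-suc↔ B) (enumeration rest) }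
    where
    rest : Finite (B zero ⊎ Σ (Fin n) (B ∘ suc))
    rest = finite-⊎ (fin zero) (finite-Σ-Fin (fin ∘ suc))

  finite-Σ : ∀ {A} {B : A → Set} → Finite A → (∀ a → Finite (B a)) → Finite (Σ A B)
  finite-Σ {B = B} a fin = record
    { size = size indexed
    ; enumeration = ↔-trans (↔-sym (Σ-↔ (↔-sym (enumeration a)) ↔-refl)) (enumeration indexed) }
    where
    indexed : Finite (Σ (Fin (size a)) (B ∘ Finite.decode a))
    indexed = finite-Σ-Fin (fin ∘ Finite.decode a)

Σ-True-≡ : ∀ {A : Set} {P : A → Set} {P? : ∀ a → Dec (P a)} {x y : A}
           {p : True (P? x)} {q : True (P? y)} → x ≡ y →
           _≡_ {A = Σ A (λ a → True (P? a))} (x , p) (y , q)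
Σ-True-≡ {p = p} {q} refl = cong (_ ,_) (T-irrelevant p q)

isYes-⇔ : ∀ {A B : Set} → A ⇔ B → (a? : Dec A) (b? : Dec B) → isYes a? ≡ isYes b?
isYes-⇔ A⇔B a? b? = trans (isYes≗does a?) (trans (does-⇔ A⇔B a? b?) (sym (isYes≗does b?)))

_⊆ᵇ_ : ∀ {m} → (Fin m → Bool) → (Fin m → Bool) → Set
p ⊆ᵇ q = ∀ i → T (p i) → T (q i)

count : ∀ {m} → (Fin m → Bool) → ℕ
count {zero} p = 0
count {suc m} p = if p zero then suc (count (p ∘ suc)) else count (p ∘ suc)

count≤ : ∀ {m} (p : Fin m → Bool) → count p ≤ m
count≤ {zero} p = z≤n
count≤ {suc m} p with p zero
... | true = s≤s (count≤ (p ∘ suc))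
... | false = m≤n⇒m≤1+n (count≤ (p ∘ suc))

count-mono : ∀ {m} (p q : Fin m → Bool) → p ⊆ᵇ q → count p ≤ count q
count-mono {zero} p q p⊆q = z≤n
count-mono {suc m} p q p⊆q with p zero in p₀ | q zero in q₀
... | true | true = s≤s (count-mono _ _ (λ i → p⊆q (suc i)))
... | true | false = ⊥-elim (subst T q₀ (p⊆q zero (subst T (sym p₀) _)))
... | false | true = m≤n⇒m≤1+n (count-mono _ _ (λ i → p⊆q (suc i)))
... | false | false = count-mono _ _ (λ i → p⊆q (suc i))

count-strict : ∀ {m} (p q : Fin m → Bool) → p ⊆ᵇ q →
               ∀ i → T (q i) → ¬ T (p i) → count p < count q
count-strict {suc m} p q p⊆q i qi ¬pi with p zero in p₀ | q zero in q₀ | i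
... | true | true | zero = ⊥-elim (¬pi (subst T (sym p₀) _))
... | true | true | suc i = s≤s (count-strict _ _ (λ k → p⊆q (suc k)) i qi ¬pi)
... | true | false | _ = ⊥-elim (subst T q₀ (p⊆q zero (subst T (sym p₀) _)))
... | false | true | _ = s≤s (count-mono _ _ (λ k → p⊆q (suc k)))
... | false | false | zero = ⊥-elim (subst T q₀ qi)
... | false | false | suc i = count-strict _ _ (λ k → p⊆q (suc k)) i qi ¬pi

module _ {m} (P : ℕ → Fin m → Bool) (increasing : ∀ n → P n ⊆ᵇ P (suc n)) where

  private
    Stable : ℕ → Set
    Stable k = P (suc k) ⊆ᵇ P k

    stable? : ∀ k → Dec (Stable k)
    stable? k = all? λ i → T? (P (suc k) i) →-dec T? (P k i)

    new-element : ∀ k → ¬ Stable k → Σ (Fin m) λ i → T (P (suc k) i) × ¬ T (P k i)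
    new-element k unstable with ¬∀⟶∃¬ m _ (λ i → T? (P (suc k) i) →-dec T? (P k i)) unstable
    ... | i , ¬step with T? (P (suc k) i) | T? (P k i)
    ...   | yes new | no old = i , new , old
    ...   | _ | yes old = ⊥-elim (¬step (λ _ → old))
    ...   | no ¬new | _ = ⊥-elim (¬step (λ new → ⊥-elim (¬new new)))

    -- Each unstable stage adds an element, so by stage n either the chain
    -- was already stable or it has at least n elements.
    growth : ∀ n → (Σ ℕ λ k → k < n × Stable k) ⊎ n ≤ count (P n)
    growth zero = inj₂ z≤n
    growth (suc n) with growth n | stable? n
    ... | inj₁ (k , k<n , stable) | _ = inj₁ (k , m<n⇒m<1+n k<n , stable)
    ... | inj₂ _ | yes stable = inj₁ (n , ≤-refl , stable)
    ... | inj₂ n≤count | no unstable =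
      let (i , new , old) = new-element n unstable in
      inj₂ (≤-trans (s≤s n≤count) (count-strict (P n) (P (suc n)) (increasing n) i new old))

  chain-stabilises : Σ ℕ λ k → k ≤ m × P (suc k) ⊆ᵇ P k
  chain-stabilises with growth (suc m)
  ... | inj₁ (k , s≤s k≤m , stable) = k , k≤m , stable
  ... | inj₂ too-many = ⊥-elim (<-irrefl refl (≤-trans too-many (count≤ (P (suc m)))))

-- The least k ≤ i with T (p k), or i itself if there is none.
first : ∀ {m} → (Fin m → Bool) → Fin m → Fin m
first p zero = zero
first p (suc i) = if p zero then zero else suc (first (p ∘ suc) i)

first-satisfies : ∀ {m} (p : Fin m → Bool) i → T (p i) → T (p (first p i))
first-satisfies p zero pi = pi
first-satisfies p (suc i) pi with p zero in p₀
... | true = subst T (sym p₀) _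
... | false = first-satisfies (p ∘ suc) i pi

first-cong : ∀ {m} {p q : Fin m → Bool} → (∀ k → p k ≡ q k) →
             ∀ {i i′} → T (p i) → T (q i′) → first p i ≡ first q i′
first-cong _ {zero} {zero} _ _ = refl
first-cong {q = q} p≗q {zero} {suc _} p₀ _ with q zero in q₀
... | true = refl
... | false = ⊥-elim (subst T (trans (p≗q zero) q₀) p₀)
first-cong {p = p} p≗q {suc _} {zero} _ q₀ with p zero in p₀
... | true = refl
... | false = ⊥-elim (subst T (trans (sym (p≗q zero)) p₀) q₀)
first-cong {p = p} {q} p≗q {suc i} {suc i′} pi qi′ with p zero in p₀ | q zero in q₀
... | true | true = refl
... | false | false = cong suc (first-cong (λ k → p≗q (suc k)) pi qi′)
... | true | false = ⊥-elim (subst T (trans (sym p₀) (trans (p≗q zero) q₀)) _)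
... | false | true = ⊥-elim (subst T (trans (sym q₀) (trans (sym (p≗q zero)) p₀)) _)

sumᶠ : ∀ {n} → (Fin n → ℕ) → ℕ
sumᶠ {zero} f = 0
sumᶠ {suc n} f = f zero + sumᶠ (f ∘ suc)

≤-sumᶠ : ∀ {n} (f : Fin n → ℕ) i → f i ≤ sumᶠ f
≤-sumᶠ f zero = m≤m+n _ _
≤-sumᶠ f (suc i) = ≤-trans (≤-sumᶠ (f ∘ suc) i) (m≤n+m _ (f zero))

module FinSetFunctors (X : FinCat) where
  open FinCat X
  open Category SetF[ X ] public
    using ()
    renaming (_∘_ to _∘ₙ_; _≈_ to _≈ₙ_; id to idₙ)

  -- Set_f is represented by its skeleton, so a functor whose values are
  -- merely finite types is transported along chosen enumerations.
  record FiniteFunctor : Set₁ where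
    field
      Carrier : Fin nObj → Set
      finite : ∀ j → Finite (Carrier j)
      act : ∀ {j k} → Fin (nHom j k) → Carrier j → Carrier k
      act-id : ∀ {j} t → act (fid {j}) t ≡ t
      act-∘ : ∀ {j k l} (g : Fin (nHom k l)) (f : Fin (nHom j k)) t →
              act (fcomp g f) t ≡ act g (act f t)

    encode : ∀ j → Carrier j → Fin (size (finite j))
    encode j = Finite.encode (finite j)

    decode : ∀ j → Fin (size (finite j)) → Carrier j
    decode j = Finite.decode (finite j)

    decode-encode : ∀ j t → decode j (encode j t) ≡ t
    decode-encode j = Finite.decode-encode (finite j)

    decode-injective : ∀ j {i i′} → decode j i ≡ decode j i′ → i ≡ i′
    decode-injective j = Finite.decode-injective (finite j)

    encode-injective : ∀ j {t t′} → encode j t ≡ encode j t′ → t ≡ t′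
    encode-injective j {t} {t′} eq =
      trans (sym (decode-encode j t)) (trans (cong (decode j) eq) (decode-encode j t′))

    skeleton : FinSetFunctor X
    skeleton = record
      { S₀ = λ j → size (finite j)
      ; S₁ = λ {j} {k} f i → encode k (act f (decode j i))
      ; S-id = λ {j} i → trans (cong (encode j) (act-id _)) (Finite.encode-decode (finite j) i)
      ; S-∘ = λ {j} {k} {l} g f i → cong (encode l) (trans (act-∘ g f _)
                (cong (act g) (sym (decode-encode k _))))
      }

    decode-natural : ∀ {j k} (f : Fin (nHom j k)) i →
                     decode k (S₁ skeleton f i) ≡ act f (decode j i)
    decode-natural {k = k} f i = decode-encode k _

    encode-natural : ∀ {j k} (f : Fin (nHom j k)) t →
                     encode k (act f t) ≡ S₁ skeleton f (encode j t)
    encode-natural {j} {k} f t = cong (encode k ∘ act f) (sym (decode-encode j t))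

    into : ∀ {A : FinSetFunctor X} (φ : ∀ j → Fin (S₀ A j) → Carrier j) →
           (∀ {j k} (f : Fin (nHom j k)) x → φ k (S₁ A f x) ≡ act f (φ j x)) →
           NatTrans A skeleton
    into φ natural-φ = record
      { η = λ j → encode j ∘ φ j
      ; natural = λ {j} {k} f x → trans (cong (encode k) (natural-φ f x)) (encode-natural f (φ j x)) }

    outof : ∀ {B : FinSetFunctor X} (ψ : ∀ j → Carrier j → Fin (S₀ B j)) →
            (∀ {j k} (f : Fin (nHom j k)) t → ψ k (act f t) ≡ S₁ B f (ψ j t)) →
            NatTrans skeleton B
    outof ψ natural-ψ = record
      { η = λ j → ψ j ∘ decode j
      ; natural = λ {j} {k} f i → trans (cong (ψ k) (decode-natural f i)) (natural-ψ f (decode j i)) }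

  open FiniteFunctor public using (skeleton; into; outof)

  Injectiveₙ : ∀ {A B : FinSetFunctor X} → NatTrans A B → Set
  Injectiveₙ m = ∀ j → Injective _≡_ _≡_ (η m j)

  representable : Fin nObj → FinSetFunctor X
  representable i = record { S₀ = nHom i ; S₁ = fcomp ; S-id = fidˡ ; S-∘ = fassoc }

  yoneda : ∀ (A : FinSetFunctor X) {i} → Fin (S₀ A i) → NatTrans (representable i) A
  yoneda A x = record { η = λ j g → S₁ A g x ; natural = λ f g → S-∘ A f g x }

  mono⇒injective : ∀ {A B : FinSetFunctor X} (m : NatTrans A B) → Mono SetF[ X ] m → Injectiveₙ m
  mono⇒injective {A} {B} m mono j {x} {y} eq =
    trans (sym (S-id A x)) (trans (mono (yoneda A x) (yoneda A y) agree j fid) (S-id A y))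
    where
    agree : ∀ k f → η m k (S₁ A f x) ≡ η m k (S₁ A f y)
    agree k f = trans (natural m f x) (trans (cong (S₁ B f) eq) (sym (natural m f y)))

  injective⇒mono : ∀ {A B : FinSetFunctor X} (m : NatTrans A B) → Injectiveₙ m → Mono SetF[ X ] m
  injective⇒mono m inj g h eq j x = inj j (eq j x)

  factor-through-injective :
    ∀ {A B C : FinSetFunctor X} (m : NatTrans B C) → Injectiveₙ m → (h : NatTrans A C) →
    (∀ j x → Σ (Fin (S₀ B j)) λ y → η m j y ≡ η h j x) →
    Σ (NatTrans A B) λ k → h ≈ₙ m ∘ₙ k
  factor-through-injective {A} {B} {C} m inj h lift = k , λ j x → sym (proj₂ (lift j x))
    where
    k : NatTrans A B
    k = record
      { η = λ j x → proj₁ (lift j x)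
      ; natural = λ {j} {l} f x → inj l (begin
          η m l (proj₁ (lift l (S₁ A f x)))  ≡⟨ proj₂ (lift l _) ⟩
          η h l (S₁ A f x)                   ≡⟨ natural h f x ⟩
          S₁ C f (η h j x)                   ≡⟨ cong (S₁ C f) (sym (proj₂ (lift j x))) ⟩
          S₁ C f (η m j (proj₁ (lift j x)))  ≡⟨ natural m f _ ⟨
          η m l (S₁ B f (proj₁ (lift j x)))  ∎) }
      where open ≡-Reasoning

  module Subfunctor (B : FinSetFunctor X) (P : ∀ j → Fin (S₀ B j) → Set)
                    (P? : ∀ j x → Dec (P j x))
                    (closed : ∀ {j k} (f : Fin (nHom j k)) x → P j x → P k (S₁ B f x)) where

    opaque
      members : FiniteFunctor
      members = record
        { Carrier = λ j → Σ (Fin (S₀ B j)) λ x → True (P? j x)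
        ; finite = λ j → finite-Σ-Fin λ x → finite-T _
        ; act = λ f (x , p) → S₁ B f x , fromWitness (closed f x (toWitness p))
        ; act-id = λ (x , _) → Σ-True-≡ (S-id B x)
        ; act-∘ = λ g f (x , _) → Σ-True-≡ (S-∘ B g f x)
        }
      open FiniteFunctor members using (decode; decode-encode; decode-injective)

      Sub : FinSetFunctor X
      Sub = skeleton members

      incl : NatTrans Sub B
      incl = outof members (λ j → proj₁) (λ f t → refl)

      incl-injective : Injectiveₙ incl
      incl-injective j eq = decode-injective j (Σ-True-≡ eq)

      incl-member : ∀ j w → P j (η incl j w)
      incl-member j w = toWitness (proj₂ (decode j w))

      restrict : ∀ {A : FinSetFunctor X} (h : NatTrans A B) → (∀ j x → P j (η h j x)) → NatTrans A Sub
      restrict h inside =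
        into members (λ j x → η h j x , fromWitness (inside j x)) (λ f x → Σ-True-≡ (natural h f x))

      incl∘restrict : ∀ {A : FinSetFunctor X} (h : NatTrans A B) inside → h ≈ₙ incl ∘ₙ restrict h inside
      incl∘restrict h inside j x = sym (cong proj₁ (decode-encode j _))

  module Relation (A B : FinSetFunctor X)
                  (R : ∀ j → Fin (S₀ A j) → Fin (S₀ B j) → Set)
                  (R? : ∀ j x y → Dec (R j x y))
                  (closed : ∀ {j k} (f : Fin (nHom j k)) x y → R j x y → R k (S₁ A f x) (S₁ B f y))
                  where

    opaque
      related-pairs : FiniteFunctor
      related-pairs = record
        { Carrier = λ j → Σ (Fin (S₀ A j) × Fin (S₀ B j)) λ (x , y) → True (R? j x y)
        ; finite = λ j → finite-Σ (finite-Σ-Fin λ _ → finite-Fin _) λ _ → finite-T _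
        ; act = λ f ((x , y) , r) → (S₁ A f x , S₁ B f y) , fromWitness (closed f x y (toWitness r))
        ; act-id = λ ((x , y) , _) → Σ-True-≡ (cong₂ _,_ (S-id A x) (S-id B y))
        ; act-∘ = λ g f ((x , y) , _) → Σ-True-≡ (cong₂ _,_ (S-∘ A g f x) (S-∘ B g f y))
        }
      open FiniteFunctor related-pairs using (encode; decode; decode-encode; decode-injective)

      Rel : FinSetFunctor X
      Rel = skeleton related-pairs

      ρ₁ : NatTrans Rel A
      ρ₁ = outof related-pairs (λ j → proj₁ ∘ proj₁) (λ f t → refl)

      ρ₂ : NatTrans Rel B
      ρ₂ = outof related-pairs (λ j → proj₂ ∘ proj₁) (λ f t → refl)

      related : ∀ j w → R j (η ρ₁ j w) (η ρ₂ j w)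
      related j w = toWitness (proj₂ (decode j w))

      element : ∀ j x y → R j x y → Fin (S₀ Rel j)
      element j x y r = encode j ((x , y) , fromWitness r)

      ρ₁-element : ∀ j x y r → η ρ₁ j (element j x y r) ≡ x
      ρ₁-element j x y r = cong (proj₁ ∘ proj₁) (decode-encode j _)

      ρ₂-element : ∀ j x y r → η ρ₂ j (element j x y r) ≡ y
      ρ₂-element j x y r = cong (proj₂ ∘ proj₁) (decode-encode j _)

      ρ-injective : ∀ j {w w′} → η ρ₁ j w ≡ η ρ₁ j w′ → η ρ₂ j w ≡ η ρ₂ j w′ → w ≡ w′
      ρ-injective j eq₁ eq₂ = decode-injective j (Σ-True-≡ (cong₂ _,_ eq₁ eq₂))

      lift : ∀ {C : FinSetFunctor X} (h₁ : NatTrans C A) (h₂ : NatTrans C B) →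
             (∀ j x → R j (η h₁ j x) (η h₂ j x)) → NatTrans C Rel
      lift h₁ h₂ r = into related-pairs (λ j x → (η h₁ j x , η h₂ j x) , fromWitness (r j x))
                          (λ f x → Σ-True-≡ (cong₂ _,_ (natural h₁ f x) (natural h₂ f x)))

      ρ₁∘lift : ∀ {C : FinSetFunctor X} (h₁ : NatTrans C A) (h₂ : NatTrans C B) r →
                ρ₁ ∘ₙ lift h₁ h₂ r ≈ₙ h₁
      ρ₁∘lift h₁ h₂ r j x = cong (proj₁ ∘ proj₁) (decode-encode j _)

      ρ₂∘lift : ∀ {C : FinSetFunctor X} (h₁ : NatTrans C A) (h₂ : NatTrans C B) r →
                ρ₂ ∘ₙ lift h₁ h₂ r ≈ₙ h₂
      ρ₂∘lift h₁ h₂ r j x = cong (proj₂ ∘ proj₁) (decode-encode j _)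

  module Product (A B : FinSetFunctor X) where
    open Relation A B (λ _ _ _ → ⊤) (λ _ _ _ → yes tt) (λ _ _ _ _ → tt) public
      using (lift)
      renaming (Rel to Prod; ρ₁ to π₁; ρ₂ to π₂; ρ-injective to π-injective)
    open Relation A B (λ _ _ _ → ⊤) (λ _ _ _ → yes tt) (λ _ _ _ _ → tt)
      using (ρ₁∘lift; ρ₂∘lift)

    ⟨_,_⟩ : ∀ {C : FinSetFunctor X} → NatTrans C A → NatTrans C B → NatTrans C Prod
    ⟨ h₁ , h₂ ⟩ = lift h₁ h₂ (λ _ _ → tt)

    π₁∘⟨,⟩ : ∀ {C : FinSetFunctor X} (h₁ : NatTrans C A) (h₂ : NatTrans C B) → π₁ ∘ₙ ⟨ h₁ , h₂ ⟩ ≈ₙ h₁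
    π₁∘⟨,⟩ h₁ h₂ = ρ₁∘lift h₁ h₂ _

    π₂∘⟨,⟩ : ∀ {C : FinSetFunctor X} (h₁ : NatTrans C A) (h₂ : NatTrans C B) → π₂ ∘ₙ ⟨ h₁ , h₂ ⟩ ≈ₙ h₂
    π₂∘⟨,⟩ h₁ h₂ = ρ₂∘lift h₁ h₂ _

    ⟨,⟩-injective : ∀ {C C′ : FinSetFunctor X} {h₁ : NatTrans C A} {h₂ : NatTrans C B}
                      {k₁ : NatTrans C′ A} {k₂ : NatTrans C′ B} {j x y} →
                    η ⟨ h₁ , h₂ ⟩ j x ≡ η ⟨ k₁ , k₂ ⟩ j y →
                    (η h₁ j x ≡ η k₁ j y) × (η h₂ j x ≡ η k₂ j y)
    ⟨,⟩-injective {h₁ = h₁} {h₂} {k₁} {k₂} {j} {x} {y} eq =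
      trans (sym (π₁∘⟨,⟩ h₁ h₂ j x)) (trans (cong (η π₁ j) eq) (π₁∘⟨,⟩ k₁ k₂ j y)) ,
      trans (sym (π₂∘⟨,⟩ h₁ h₂ j x)) (trans (cong (η π₂ j) eq) (π₂∘⟨,⟩ k₁ k₂ j y))

    ⟨,⟩-cong : ∀ {C C′ : FinSetFunctor X} {h₁ : NatTrans C A} {h₂ : NatTrans C B}
                 {k₁ : NatTrans C′ A} {k₂ : NatTrans C′ B} {j x y} →
               η h₁ j x ≡ η k₁ j y → η h₂ j x ≡ η k₂ j y →
               η ⟨ h₁ , h₂ ⟩ j x ≡ η ⟨ k₁ , k₂ ⟩ j y
    ⟨,⟩-cong {h₁ = h₁} {h₂} {k₁} {k₂} {j} {x} {y} eq₁ eq₂ = π-injective j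
      (trans (π₁∘⟨,⟩ h₁ h₂ j x) (trans eq₁ (sym (π₁∘⟨,⟩ k₁ k₂ j y))))
      (trans (π₂∘⟨,⟩ h₁ h₂ j x) (trans eq₂ (sym (π₂∘⟨,⟩ k₁ k₂ j y))))

  Covers : ∀ {B U : FinSetFunctor X} {k} {S : Fin k → FinSetFunctor X} →
           (∀ i → NatTrans (S i) B) → NatTrans U B → Set
  Covers {k = k} {S} ms u =
    ∀ j y → Σ (Fin k) λ i → Σ (Fin (S₀ (S i) j)) λ z → η (ms i) j z ≡ η u j y

  module JointImage {B : FinSetFunctor X} {k} {S : Fin k → FinSetFunctor X}
                    (ms : ∀ i → NatTrans (S i) B) where

    Hit : ∀ j → Fin (S₀ B j) → Set
    Hit j y = Σ (Fin k) λ i → Σ (Fin (S₀ (S i) j)) λ z → η (ms i) j z ≡ y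

    opaque
      hit? : ∀ j y → Dec (Hit j y)
      hit? j y = any? λ i → any? λ z → η (ms i) j z ≟ y

    hit-closed : ∀ {j l} (f : Fin (nHom j l)) y → Hit j y → Hit l (S₁ B f y)
    hit-closed f y (i , z , refl) = i , S₁ (S i) f z , natural (ms i) f z

    open Subfunctor B Hit hit? hit-closed public

    hit-by : ∀ i j z → Hit j (η (ms i) j z)
    hit-by i j z = i , z , refl

    corestrict : ∀ i → NatTrans (S i) Sub
    corestrict i = restrict (ms i) (hit-by i)

    ms≈incl∘corestrict : ∀ i → ms i ≈ₙ incl ∘ₙ corestrict i
    ms≈incl∘corestrict i = incl∘restrict (ms i) (hit-by i)

    incl-covered : Covers ms incl
    incl-covered j w = incl-member j w

  union⇒covers : ∀ {B U : FinSetFunctor X} k S (ms : ∀ i → NatTrans (S i) B) (u : NatTrans U B) →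
                 IsUnion SetF[ X ] k S ms u → Covers ms u
  union⇒covers k S ms u (_ , _ , least) j y =
    let (t , u≈incl∘t) = least incl (injective⇒mono incl incl-injective)
                               (λ i → corestrict i , ms≈incl∘corestrict i)
        (i , z , hit) = incl-covered j (η t j y) in
    i , z , trans hit (sym (u≈incl∘t j y))
    where open JointImage ms

  image⇒union : ∀ {A B I : FinSetFunctor X} (f : NatTrans A B) e (m : NatTrans I B) →
                IsImage SetF[ X ] f e m → IsUnion SetF[ X ] 1 (λ _ → A) (λ _ → f) m
  image⇒union f e m (mono , f≈m∘e , least) =
    mono , (λ _ → e , f≈m∘e) ,
    λ v mono-v through → least (proj₁ (through zero)) v mono-v (proj₂ (through zero))

  image⇒covers : ∀ {A B I : FinSetFunctor X} (f : NatTrans A B) e (m : NatTrans I B) →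
                 IsImage SetF[ X ] f e m → ∀ j w → Σ (Fin (S₀ A j)) λ x → η f j x ≡ η m j w
  image⇒covers f e m im j w =
    let (_ , x , hit) = union⇒covers 1 _ (λ _ → f) m (image⇒union f e m im) j w in x , hit

  covers⇒union : ∀ {B U : FinSetFunctor X} k S (ms : ∀ i → NatTrans (S i) B) (u : NatTrans U B) →
                 Injectiveₙ u → (∀ i → Σ (NatTrans (S i) U) λ t → ms i ≈ₙ u ∘ₙ t) → Covers ms u →
                 IsUnion SetF[ X ] k S ms u
  covers⇒union k S ms u inj through covered =
    injective⇒mono u inj , through ,
    λ v mono-v v-through → factor-through-injective v (mono⇒injective v mono-v) u λ j y →
      let (i , z , hit) = covered j y ; (t , ms≈v∘t) = v-through i in
      η t j z , trans (sym (ms≈v∘t j z)) hit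

  module Image {A B : FinSetFunctor X} (h : NatTrans A B) where
    open JointImage {k = 1} {λ _ → A} (λ _ → h) public using (Sub; incl; incl-injective)
    open JointImage {k = 1} {λ _ → A} (λ _ → h) using (corestrict; ms≈incl∘corestrict; incl-covered)

    factor : NatTrans A Sub
    factor = corestrict zero

    h≈incl∘factor : h ≈ₙ incl ∘ₙ factor
    h≈incl∘factor = ms≈incl∘corestrict zero

    image-covered : ∀ j w → Σ (Fin (S₀ A j)) λ x → η h j x ≡ η incl j w
    image-covered j w = let (_ , x , hit) = incl-covered j w in x , hit

    isImage : IsImage SetF[ X ] h factor incl
    isImage = injective⇒mono incl incl-injective , h≈incl∘factor ,
      λ e′ m′ mono′ h≈m′∘e′ → factor-through-injective m′ (mono⇒injective m′ mono′) incl λ j w →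
        let (x , hit) = image-covered j w in η e′ j x , trans (sym (h≈m′∘e′ j x)) hit

  record Covering {U B : FinSetFunctor X} (u : NatTrans U B) : Set₁ where
    field
      Index : Set
      index-finite : Finite Index
      Source : Index → FinSetFunctor X
      part : ∀ i → NatTrans (Source i) B
      u-injective : Injectiveₙ u
      within : ∀ i j x → Σ (Fin (S₀ U j)) λ y → η u j y ≡ η (part i) j x
      covers : ∀ j y → Σ Index λ i → Σ (Fin (S₀ (Source i) j)) λ x → η (part i) j x ≡ η u j y

    index : Fin (size index-finite) → Index
    index = Finite.decode index-finite

    module Im (t : Fin (size index-finite)) = Image (part (index t))

    images-union : IsUnion SetF[ X ] (size index-finite) Im.Sub Im.incl u
    images-union = covers⇒union _ Im.Sub Im.incl u u-injective through covered
      where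
      through : ∀ t → Σ (NatTrans (Im.Sub t) U) λ s → Im.incl t ≈ₙ u ∘ₙ s
      through t = factor-through-injective u u-injective (Im.incl t) λ j w →
        let (x , hit) = Im.image-covered t j w ; (y , u≡part) = within (index t) j x in
        y , trans u≡part hit
      covered : Covers Im.incl u
      covered j y =
        let (i , x , hit) = covers j y
            (x′ , hit′) = subst (λ i → Σ (Fin (S₀ (Source i) j)) λ x → η (part i) j x ≡ η u j y)
                                (sym (Finite.decode-encode index-finite i)) (x , hit)
            t = Finite.encode index-finite i in
        t , η (Im.factor t) j x′ , trans (sym (Im.h≈incl∘factor t j x′)) hit′

  record SpanCover (A B : FinSetFunctor X) (R : ∀ j → Fin (S₀ A j) → Fin (S₀ B j) → Set) : Set₁ where
    field
      Index : Set
      index-finite : Finite Index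
      Source : Index → FinSetFunctor X
      σ₁ : ∀ i → NatTrans (Source i) A
      σ₂ : ∀ i → NatTrans (Source i) B
      sound : ∀ i j s → R j (η (σ₁ i) j s) (η (σ₂ i) j s)
      complete : ∀ j x y → R j x y →
                 Σ Index λ i → Σ (Fin (S₀ (Source i) j)) λ s → (η (σ₁ i) j s ≡ x) × (η (σ₂ i) j s ≡ y)

  module _ {A B : FinSetFunctor X} {R : ∀ j → Fin (S₀ A j) → Fin (S₀ B j) → Set}
           (R? : ∀ j x y → Dec (R j x y))
           (closed : ∀ {j k} (f : Fin (nHom j k)) x y → R j x y → R k (S₁ A f x) (S₁ B f y)) where
    open Relation A B R R? closed
    open Product A B

    span-covering : SpanCover A B R → Covering ⟨ ρ₁ , ρ₂ ⟩
    span-covering cover = record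
      { Index = Index
      ; index-finite = index-finite
      ; Source = Source
      ; part = λ i → ⟨ σ₁ i , σ₂ i ⟩
      ; u-injective = λ j eq →
          let (eq₁ , eq₂) = ⟨,⟩-injective {h₁ = ρ₁} {ρ₂} {ρ₁} {ρ₂} eq in ρ-injective j eq₁ eq₂
      ; within = λ i j s → element j _ _ (sound i j s) ,
          ⟨,⟩-cong {h₁ = ρ₁} {ρ₂} {σ₁ i} {σ₂ i} (ρ₁-element j _ _ _) (ρ₂-element j _ _ _)
      ; covers = λ j w → let (i , s , eq₁ , eq₂) = complete j _ _ (related j w) in
          i , s , ⟨,⟩-cong {h₁ = σ₁ i} {σ₂ i} {ρ₁} {ρ₂} eq₁ eq₂
      }
      where open SpanCover cover

  limit-surjective :
    ∀ {D : FinCat} {G : Functor (FC D) SetF[ X ]} (P : Cone G) → IsLimit P →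
    ∀ j (x : ∀ a → Fin (S₀ (Functor.F₀ G a) j)) →
    (∀ {a b} (f : Fin (FinCat.nHom D a b)) → η (Functor.F₁ G f) j (x a) ≡ x b) →
    Σ (Fin (S₀ (Cone.apex P) j)) λ z → ∀ a → η (Cone.leg P a) j z ≡ x a
  limit-surjective {G = G} P limit j x compatible =
    let (u , legs , _) = limit elements in
    η u j fid , λ a → trans (legs a j fid) (S-id (Functor.F₀ G a) (x a))
    where
    elements : Cone G
    elements = record
      { apex = representable j
      ; leg = λ a → yoneda (Functor.F₀ G a) (x a)
      ; commute = λ {a} {b} f k g →
          trans (natural (Functor.F₁ G f) g (x a)) (cong (S₁ (Functor.F₀ G b) g) (compatible f))
      }

  module _ {D : FinCat} {G : Functor (FC D) SetF[ X ]} (K : Cocone G)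
           (surjective : Covers (Cocone.coleg K) idₙ)
           (kernel : ∀ (K′ : Cocone G) {a b j x y} →
                     η (Cocone.coleg K a) j x ≡ η (Cocone.coleg K b) j y →
                     η (Cocone.coleg K′ a) j x ≡ η (Cocone.coleg K′ b) j y) where
    open Cocone

    jointly-surjective⇒colimit : IsColimit K
    jointly-surjective⇒colimit K′ = mediate , factors , unique
      where
      mediate : NatTrans (coapex K) (coapex K′)
      mediate = record
        { η = λ j y → let (a , x , _) = surjective j y in η (coleg K′ a) j x
        ; natural = λ {j} {k} f y →
            let (a , x , hit) = surjective j y
                (b , z , hit′) = surjective k (S₁ (coapex K) f y) in
            trans (kernel K′ (trans hit′ (trans (cong (S₁ (coapex K) f) (sym hit))
                                                (sym (natural (coleg K a) f x)))))
                  (natural (coleg K′ a) f x)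
        }
      factors : ∀ a → mediate ∘ₙ coleg K a ≈ₙ coleg K′ a
      factors a j x = let (_ , _ , hit) = surjective j (η (coleg K a) j x) in kernel K′ hit
      unique : ∀ u → (∀ a → u ∘ₙ coleg K a ≈ₙ coleg K′ a) → u ≈ₙ mediate
      unique u u-factors j y = let (a , x , hit) = surjective j y in
        trans (cong (η u j) (sym hit)) (u-factors a j x)

module Cospan where
  pattern left = zero
  pattern right = suc zero
  pattern sink = suc (suc zero)

  arrows : Fin 3 → Fin 3 → ℕ
  arrows left left = 1
  arrows right right = 1
  arrows sink sink = 1
  arrows left sink = 1
  arrows right sink = 1
  arrows _ _ = 0

  compose : ∀ {a b c} → Fin (arrows b c) → Fin (arrows a b) → Fin (arrows a c)
  compose {left} {left} g _ = g
  compose {right} {right} g _ = g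
  compose {sink} {sink} g _ = g
  compose {left} {sink} {sink} _ f = f
  compose {right} {sink} {sink} _ f = f
  compose {left} {sink} {left} () _
  compose {left} {sink} {right} () _
  compose {right} {sink} {left} () _
  compose {right} {sink} {right} () _
  compose {left} {right} _ ()
  compose {right} {left} _ ()
  compose {sink} {left} _ ()
  compose {sink} {right} _ ()

  identity : ∀ {a} → Fin (arrows a a)
  identity {left} = zero
  identity {right} = zero
  identity {sink} = zero

  arrow-unique : ∀ {a b} (f g : Fin (arrows a b)) → f ≡ g
  arrow-unique {left} {left} zero zero = refl
  arrow-unique {right} {right} zero zero = refl
  arrow-unique {sink} {sink} zero zero = refl
  arrow-unique {left} {sink} zero zero = refl
  arrow-unique {right} {sink} zero zero = refl
  arrow-unique {left} {right} ()
  arrow-unique {right} {left} ()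
  arrow-unique {sink} {left} ()
  arrow-unique {sink} {right} ()

  cospan : FinCat
  cospan = record
    { nObj = 3 ; nHom = arrows ; fid = identity ; fcomp = compose
    ; fidˡ = λ _ → arrow-unique _ _ ; fidʳ = λ _ → arrow-unique _ _
    ; fassoc = λ _ _ _ → arrow-unique _ _ }

  module _ (C : Category) {A B Z : Category.Obj C}
           (f : Category.Hom C A Z) (g : Category.Hom C B Z) where
    open Category C renaming (_∘_ to _∘ᶜ_)

    vertex : Fin 3 → Obj
    vertex left = A
    vertex right = B
    vertex sink = Z

    edge : ∀ {a b} → Fin (arrows a b) → Hom (vertex a) (vertex b)
    edge {left} {left} _ = id
    edge {right} {right} _ = id
    edge {sink} {sink} _ = id
    edge {left} {sink} _ = f
    edge {right} {sink} _ = g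
    edge {left} {right} ()
    edge {right} {left} ()
    edge {sink} {left} ()
    edge {sink} {right} ()

    edge-∘ : ∀ {a b c} (y : Fin (arrows b c)) (x : Fin (arrows a b)) →
             edge (compose y x) ≈ edge y ∘ᶜ edge x
    edge-∘ {left} {left} y _ = ≈-sym (identityʳ _)
    edge-∘ {right} {right} y _ = ≈-sym (identityʳ _)
    edge-∘ {sink} {sink} y _ = ≈-sym (identityʳ _)
    edge-∘ {left} {sink} {sink} _ x = ≈-sym (identityˡ _)
    edge-∘ {right} {sink} {sink} _ x = ≈-sym (identityˡ _)
    edge-∘ {left} {sink} {left} () _
    edge-∘ {left} {sink} {right} () _
    edge-∘ {right} {sink} {left} () _
    edge-∘ {right} {sink} {right} () _
    edge-∘ {left} {right} _ ()
    edge-∘ {right} {left} _ ()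
    edge-∘ {sink} {left} _ ()
    edge-∘ {sink} {right} _ ()

    diagram : Functor (FC cospan) C
    diagram = record
      { F₀ = vertex ; F₁ = edge
      ; F-resp-≈ = λ { refl → ≈-refl }
      ; F-id = λ { {left} → ≈-refl ; {right} → ≈-refl ; {sink} → ≈-refl }
      ; F-∘ = edge-∘ }

    square : ∀ {P} (p₁ : Hom P A) (p₂ : Hom P B) → f ∘ᶜ p₁ ≈ g ∘ᶜ p₂ → Cone diagram
    square {P} p₁ p₂ commutes = record { apex = P ; leg = leg ; commute = commute }
      where
      leg : ∀ a → Hom P (vertex a)
      leg left = p₁
      leg right = p₂
      leg sink = f ∘ᶜ p₁
      commute : ∀ {a b} (x : Fin (arrows a b)) → edge x ∘ᶜ leg a ≈ leg b
      commute {left} {left} _ = identityˡ _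
      commute {right} {right} _ = identityˡ _
      commute {sink} {sink} _ = identityˡ _
      commute {left} {sink} _ = ≈-refl
      commute {right} {sink} _ = ≈-sym commutes
      commute {left} {right} ()
      commute {right} {left} ()
      commute {sink} {left} ()
      commute {sink} {right} ()

  pullback-surjective :
    ∀ {X} (G : Functor (FC cospan) SetF[ X ]) (P : Cone G) → IsLimit P →
    let open Functor G in
    ∀ j x y → η (F₁ {left} {sink} zero) j x ≡ η (F₁ {right} {sink} zero) j y →
    Σ (Fin (S₀ (Cone.apex P) j)) λ z → (η (Cone.leg P left) j z ≡ x) × (η (Cone.leg P right) j z ≡ y)
  pullback-surjective {X} G P limit j x y meet =
    let (z , legs) = limit-surjective P limit j point compatible in z , legs left , legs right
    where
    open FinSetFunctors X using (limit-surjective)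
    open Functor G
    point : ∀ a → Fin (S₀ (F₀ a) j)
    point left = x
    point right = y
    point sink = η (F₁ {left} {sink} zero) j x
    compatible : ∀ {a b} (e : Fin (arrows a b)) → η (F₁ e) j (point a) ≡ point b
    compatible {left} {left} zero = F-id j x
    compatible {right} {right} zero = F-id j y
    compatible {sink} {sink} zero = F-id j (point sink)
    compatible {left} {sink} zero = refl
    compatible {right} {sink} zero = sym meet
    compatible {left} {right} ()
    compatible {right} {left} ()
    compatible {sink} {left} ()
    compatible {sink} {right} ()

module Zigzags {X D : FinCat} (F : Functor (FC D) SetF[ X ]) where
  open FinSetFunctors X
  open FinCat X using (nObj; nHom)
  open FinCat D using () renaming (nObj to nD; nHom to hD; fid to idD)
  open Functor F

  Step : ∀ b c j → Fin (S₀ (F₀ b) j) → Fin (S₀ (F₀ c) j) → Set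
  Step b c j y z = (Σ (Fin (hD b c)) λ f → η (F₁ f) j y ≡ z)
                 ⊎ (Σ (Fin (hD c b)) λ g → y ≡ η (F₁ g) j z)

  -- Zigzag n is made of n + 1 steps.
  Zigzag : ℕ → ∀ a c j → Fin (S₀ (F₀ a) j) → Fin (S₀ (F₀ c) j) → Set
  Zigzag zero a c j x z = Step a c j x z
  Zigzag (suc n) a c j x z =
    Σ (Fin nD) λ b → Σ (Fin (S₀ (F₀ b) j)) λ y → Zigzag n a b j x y × Step b c j y z

  opaque
    step? : ∀ b c j y z → Dec (Step b c j y z)
    step? b c j y z = any? (λ f → η (F₁ f) j y ≟ z) ⊎-dec any? (λ g → y ≟ η (F₁ g) j z)

    zigzag? : ∀ n a c j x z → Dec (Zigzag n a c j x z)
    zigzag? zero = step?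
    zigzag? (suc n) a c j x z = any? λ b → any? λ y → zigzag? n a b j x y ×-dec step? b c j y z

  step-closed : ∀ {b c j k} (g : Fin (nHom j k)) y z →
                Step b c j y z → Step b c k (S₁ (F₀ b) g y) (S₁ (F₀ c) g z)
  step-closed g y z (inj₁ (f , refl)) = inj₁ (f , natural (F₁ f) g y)
  step-closed g y z (inj₂ (f , refl)) = inj₂ (f , sym (natural (F₁ f) g z))

  zigzag-closed : ∀ n {a c j k} (g : Fin (nHom j k)) x z →
                  Zigzag n a c j x z → Zigzag n a c k (S₁ (F₀ a) g x) (S₁ (F₀ c) g z)
  zigzag-closed zero = step-closed
  zigzag-closed (suc n) g x z (b , y , r , s) =
    b , S₁ (F₀ b) g y , zigzag-closed n g x y r , step-closed g y z s

  step-refl : ∀ {a j} x → Step a a j x x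
  step-refl {j = j} x = inj₁ (idD , F-id j x)

  step-sym : ∀ {b c j y z} → Step b c j y z → Step c b j z y
  step-sym (inj₁ (f , eq)) = inj₂ (f , sym eq)
  step-sym (inj₂ (g , eq)) = inj₁ (g , sym eq)

  zigzag-cons : ∀ n {a b c j x y z} → Step a b j x y → Zigzag n b c j y z → Zigzag (suc n) a c j x z
  zigzag-cons zero s r = _ , _ , s , r
  zigzag-cons (suc n) s (b , y , r , s′) = b , y , zigzag-cons n s r , s′

  zigzag-sym : ∀ n {a c j x z} → Zigzag n a c j x z → Zigzag n c a j z x
  zigzag-sym zero s = step-sym s
  zigzag-sym (suc n) (b , y , r , s) = zigzag-cons n (step-sym s) (zigzag-sym n r)

  zigzag-++ : ∀ n m {a b c j x y z} → Zigzag n a b j x y → Zigzag m b c j y z →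
              Zigzag (suc (m + n)) a c j x z
  zigzag-++ n zero r s = _ , _ , r , s
  zigzag-++ n (suc m) r (b , y , r′ , s) = b , y , zigzag-++ n m r r′ , s

  zigzag-extend : ∀ n {a c j x z} → Zigzag n a c j x z → Zigzag (suc n) a c j x z
  zigzag-extend n r = _ , _ , r , step-refl _

  zigzag-mono : ∀ {n n′} → n ≤ n′ → ∀ {a c j x z} → Zigzag n a c j x z → Zigzag n′ a c j x z
  zigzag-mono {n′ = zero} z≤n r = r
  zigzag-mono {n′ = suc n′} z≤n r = zigzag-extend n′ (zigzag-mono z≤n r)
  zigzag-mono (s≤s n≤n′) (b , y , r , s) = b , y , zigzag-mono n≤n′ r , s

  Elem : Fin nObj → Set
  Elem j = Σ (Fin nD) λ a → Fin (S₀ (F₀ a) j)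

  coproduct : FiniteFunctor
  coproduct = record
    { Carrier = Elem
    ; finite = λ j → finite-Σ-Fin λ _ → finite-Fin _
    ; act = λ g (a , x) → a , S₁ (F₀ a) g x
    ; act-id = λ (a , x) → cong (a ,_) (S-id (F₀ a) x)
    ; act-∘ = λ g f (a , x) → cong (a ,_) (S-∘ (F₀ a) g f x)
    }
  open FiniteFunctor coproduct
    using (encode; decode; decode-encode; act; act-id; act-∘)
    renaming (finite to elements-finite)

  module _ {j} (a : Fin nD) (x : Fin (S₀ (F₀ a) j)) where
    private
      reached : ℕ → Fin (size (elements-finite j)) → Bool
      reached n i = isYes (zigzag? n a (proj₁ (decode j i)) j x (proj₂ (decode j i)))

      stabilisation : Σ ℕ λ k → k ≤ size (elements-finite j) × reached (suc k) ⊆ᵇ reached k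
      stabilisation = chain-stabilises reached λ n i r → fromWitness (zigzag-extend n (toWitness r))

      k : ℕ
      k = proj₁ stabilisation

      stable : ∀ c z → Zigzag (suc k) a c j x z → Zigzag k a c j x z
      stable c z r = subst (λ (c , z) → Zigzag k a c j x z) (decode-encode j (c , z))
        (toWitness (proj₂ (proj₂ stabilisation) (encode j (c , z))
          (fromWitness (subst (λ (c , z) → Zigzag (suc k) a c j x z)
                              (sym (decode-encode j (c , z))) r))))

      saturate : ∀ n c z → Zigzag n a c j x z → Zigzag k a c j x z
      saturate zero c z r = zigzag-mono z≤n r
      saturate (suc n) c z (b , y , r , s) = stable c z (b , y , saturate n b y r , s)

    zigzag-bounded-at : ∀ n c z → Zigzag n a c j x z → Zigzag (size (elements-finite j)) a c j x z
    zigzag-bounded-at n c z r = zigzag-mono (proj₁ (proj₂ stabilisation)) (saturate n c z r)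

  -- One length for all objects j, so that zigzags of that length form a subfunctor.
  bound : ℕ
  bound = sumᶠ λ j → size (elements-finite j)

  zigzag-bounded : ∀ n {a c j x z} → Zigzag n a c j x z → Zigzag bound a c j x z
  zigzag-bounded n {a} {c} {j} {x} {z} r =
    zigzag-mono (≤-sumᶠ (λ j → size (elements-finite j)) j) (zigzag-bounded-at a x n c z r)

  infix 4 _~_ _~?_
  _~_ : ∀ {j} → Elem j → Elem j → Set
  _~_ {j} (a , x) (c , z) = Zigzag bound a c j x z

  _~?_ : ∀ {j} (v w : Elem j) → Dec (v ~ w)
  _~?_ {j} (a , x) (c , z) = zigzag? bound a c j x z

  ~-refl : ∀ {j} {v : Elem j} → v ~ v
  ~-refl = zigzag-bounded 0 (step-refl _)

  ~-reflexive : ∀ {j} {v w : Elem j} → v ≡ w → v ~ w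
  ~-reflexive refl = ~-refl

  ~-sym : ∀ {j} {v w : Elem j} → v ~ w → w ~ v
  ~-sym = zigzag-sym bound

  ~-trans : ∀ {j} {u v w : Elem j} → u ~ v → v ~ w → u ~ w
  ~-trans r s = zigzag-bounded _ (zigzag-++ bound bound r s)

  ~-act : ∀ {j k} (g : Fin (nHom j k)) {v w : Elem j} → v ~ w → act g v ~ act g w
  ~-act g = zigzag-closed bound g _ _

  canonical : ∀ j → Elem j → Fin (size (elements-finite j))
  canonical j v = first (λ i → isYes (decode j i ~? v)) (encode j v)

  canonical-~ : ∀ j v → decode j (canonical j v) ~ v
  canonical-~ j v = toWitness (first-satisfies (λ i → isYes (decode j i ~? v)) (encode j v)
                                               (fromWitness (~-reflexive (decode-encode j v))))

  canonical-cong : ∀ j {v w} → v ~ w → canonical j v ≡ canonical j w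
  canonical-cong j {v} {w} v~w =
    first-cong same (fromWitness (~-reflexive (decode-encode j v)))
                    (fromWitness (~-reflexive (decode-encode j w)))
    where
    same : ∀ i → isYes (decode j i ~? v) ≡ isYes (decode j i ~? w)
    same i = isYes-⇔ (mk⇔ (λ u~v → ~-trans u~v v~w) (λ u~w → ~-trans u~w (~-sym v~w))) _ _

  class : ∀ j → Elem j → Σ (Fin (size (elements-finite j))) λ i → True (canonical j (decode j i) ≟ i)
  class j v = canonical j v , fromWitness (canonical-cong j (canonical-~ j v))

  classes : FiniteFunctor
  classes = record
    { Carrier = λ j → Σ (Fin (size (elements-finite j))) λ i → True (canonical j (decode j i) ≟ i)
    ; finite = λ j → finite-Σ-Fin λ _ → finite-T _
    ; act = λ {j} {k} g (i , _) → class k (act g (decode j i))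
    ; act-id = λ {j} (i , canonical-i) →
        Σ-True-≡ (trans (canonical-cong j (~-reflexive (act-id _))) (toWitness canonical-i))
    ; act-∘ = λ {j} {k} {l} g f (i , _) → Σ-True-≡ (canonical-cong l
        (~-trans (~-reflexive (act-∘ g f _)) (~-act g (~-sym (canonical-~ k _)))))
    }

  Quotient : FinSetFunctor X
  Quotient = skeleton classes

  quotient : Cocone F
  quotient = record
    { coapex = Quotient
    ; coleg = leg
    ; cocommute = λ {a} {b} f j x →
        cong (FiniteFunctor.encode classes j)
             (Σ-True-≡ (canonical-cong j (zigzag-bounded 0 (inj₂ (f , refl)))))
    }
    where
    leg : ∀ a → NatTrans (F₀ a) Quotient
    leg a = into classes (λ j x → class j (a , x)) λ {j} {k} g x →
      Σ-True-≡ (canonical-cong k (~-act g (~-sym (canonical-~ j (a , x)))))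

  module _ (K : Cocone F) where
    open Cocone K

    step-sound : ∀ {b c j y z} → Step b c j y z → η (coleg b) j y ≡ η (coleg c) j z
    step-sound {j = j} (inj₁ (f , refl)) = sym (cocommute f j _)
    step-sound {j = j} (inj₂ (g , refl)) = cocommute g j _

    zigzag-sound : ∀ n {a c j x z} → Zigzag n a c j x z → η (coleg a) j x ≡ η (coleg c) j z
    zigzag-sound zero s = step-sound s
    zigzag-sound (suc n) (b , y , r , s) = trans (zigzag-sound n r) (step-sound s)

  module Colimit (K : Cocone F) (colimit : IsColimit K) where
    open Cocone K

    colimit-kernel : ∀ {a b j x y} → η (coleg a) j x ≡ η (coleg b) j y → Zigzag bound a b j x y
    colimit-kernel {a} {b} {j} {x} {y} eq =
      ~-trans (~-sym (canonical-~ j (a , x)))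
              (~-trans (~-reflexive (cong (decode j) same-class)) (canonical-~ j (b , y)))
      where
      same-class : canonical j (a , x) ≡ canonical j (b , y)
      same-class = let (u , u-legs , _) = colimit quotient in
        cong proj₁ (FiniteFunctor.encode-injective classes j
          (trans (sym (u-legs a j x)) (trans (cong (η u j) eq) (u-legs b j y))))

    colimit-covers : Covers coleg idₙ
    colimit-covers j y =
      let (a , x , hit) = incl-covered j (η w j y) in a , x , trans hit (incl∘w≈id j y)
      where
      open JointImage coleg
      images : Cocone F
      images = record
        { coapex = Sub
        ; coleg = corestrict
        ; cocommute = λ {a} {b} f j x → incl-injective j (begin
            η incl j (η (corestrict b) j (η (Functor.F₁ F f) j x))  ≡⟨ ms≈incl∘corestrict b j _ ⟨
            η (coleg b) j (η (Functor.F₁ F f) j x)                  ≡⟨ cocommute f j x ⟩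
            η (coleg a) j x                                         ≡⟨ ms≈incl∘corestrict a j x ⟩
            η incl j (η (corestrict a) j x)                         ∎)
        }
        where open ≡-Reasoning
      w : NatTrans coapex Sub
      w = proj₁ (colimit images)
      -- incl ∘ w and the identity both mediate from K to itself.
      incl∘w≈id : incl ∘ₙ w ≈ₙ idₙ
      incl∘w≈id j y =
        let (_ , w-legs , _) = colimit images ; (_ , _ , unique) = colimit K in
        trans (unique (incl ∘ₙ w) (λ a j x → trans (cong (η incl j) (w-legs a j x))
                                                   (sym (ms≈incl∘corestrict a j x))) j y)
              (sym (unique idₙ (λ a j x → refl) j y))

    module KernelPair (a b : Fin nD) where
      open Relation (F₀ a) (F₀ b) (Zigzag bound a b) (zigzag? bound a b) (zigzag-closed bound) public

      cone : Cone (Cospan.diagram SetF[ X ] (coleg a) (coleg b))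
      cone = Cospan.square SetF[ X ] (coleg a) (coleg b) ρ₁ ρ₂
               (λ j w → zigzag-sound K bound (related j w))

      isPullback : IsLimit cone
      isPullback K′ = lift l₁ l₂ kernel , legs , unique
        where
        open Cospan using (left; right; sink)
        l₁ : NatTrans (Cone.apex K′) (F₀ a)
        l₁ = Cone.leg K′ left
        l₂ : NatTrans (Cone.apex K′) (F₀ b)
        l₂ = Cone.leg K′ right
        c₁ : coleg a ∘ₙ l₁ ≈ₙ Cone.leg K′ sink
        c₁ = Cone.commute K′ {left} {sink} zero
        c₂ : coleg b ∘ₙ l₂ ≈ₙ Cone.leg K′ sink
        c₂ = Cone.commute K′ {right} {sink} zero
        kernel : ∀ j t → Zigzag bound a b j (η l₁ j t) (η l₂ j t)
        kernel j t = colimit-kernel (trans (c₁ j t) (sym (c₂ j t)))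
        legs : ∀ v → Cone.leg cone v ∘ₙ lift l₁ l₂ kernel ≈ₙ Cone.leg K′ v
        legs left = ρ₁∘lift l₁ l₂ kernel
        legs right = ρ₂∘lift l₁ l₂ kernel
        legs sink j t = trans (cong (η (coleg a) j) (ρ₁∘lift l₁ l₂ kernel j t)) (c₁ j t)
        unique : ∀ u → (∀ v → Cone.leg cone v ∘ₙ u ≈ₙ Cone.leg K′ v) → u ≈ₙ lift l₁ l₂ kernel
        unique u u-legs j t = ρ-injective j (trans (u-legs left j t) (sym (ρ₁∘lift l₁ l₂ kernel j t)))
                                            (trans (u-legs right j t) (sym (ρ₂∘lift l₁ l₂ kernel j t)))

module Coherent {I J : FinCat} (M : Functor SetF[ J ] SetF[ I ]) (coherent : IsCoherent M) where
  open Functor M renaming (F₀ to M₀; F₁ to M₁)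
  module 𝐈 = FinSetFunctors I
  module 𝐉 = FinSetFunctors J
  open 𝐉 using (_∘ₙ_; _≈ₙ_; idₙ; Covering; SpanCover)

  preserves-limits : PreservesFiniteLimits M
  preserves-limits = proj₁ coherent

  preserves-images : PreservesImages M
  preserves-images = proj₁ (proj₂ coherent)

  preserves-unions : PreservesFiniteUnions M
  preserves-unions = proj₂ (proj₂ coherent)

  M-covers : ∀ {U B : FinSetFunctor J} {u : NatTrans U B} (cover : Covering u) →
             let open Covering cover in
             ∀ i w → Σ Index λ k → Σ (Fin (S₀ (M₀ (Source k)) i)) λ x →
                       η (M₁ (part k)) i x ≡ η (M₁ u) i w
  M-covers {u = u} cover i w =
    let (t , z , z-hit) = covered
        (x , hit) = 𝐈.image⇒covers (M₁ (part (index t))) (M₁ (Im.factor t)) (M₁ (Im.incl t))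
                                   (image t) i z in
    index t , x , trans hit z-hit
    where
    open Covering cover
    union : IsUnion SetF[ I ] _ (λ t → M₀ (Im.Sub t)) (λ t → M₁ (Im.incl t)) (M₁ u)
    union = preserves-unions _ Im.Sub Im.incl
              (λ t → 𝐉.injective⇒mono (Im.incl t) (Im.incl-injective t)) u images-union
    image : ∀ t → IsImage SetF[ I ] (M₁ (part (index t))) (M₁ (Im.factor t)) (M₁ (Im.incl t))
    image t = preserves-images (part (index t)) (Im.factor t) (Im.incl t) (Im.isImage t)
    covered : Σ (Fin (size index-finite)) λ t →
              Σ (Fin (S₀ (M₀ (Im.Sub t)) i)) λ z → η (M₁ (Im.incl t)) i z ≡ η (M₁ u) i w
    covered = 𝐈.union⇒covers (size index-finite) (λ t → M₀ (Im.Sub t)) (λ t → M₁ (Im.incl t))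
                             (M₁ u) union i w

  module _ {A B : FinSetFunctor J} {R : ∀ j → Fin (S₀ A j) → Fin (S₀ B j) → Set}
           (R? : ∀ j x y → Dec (R j x y))
           (closed : ∀ {j k} (f : Fin (FinCat.nHom J j k)) x y →
                     R j x y → R k (S₁ A f x) (S₁ B f y)) where
    open 𝐉.Relation A B R R? closed
    open 𝐉.Product A B

    M-span-covers : (cover : SpanCover A B R) → let open SpanCover cover in
                    ∀ i w → Σ Index λ k → Σ (Fin (S₀ (M₀ (Source k)) i)) λ s →
                      (η (M₁ (σ₁ k)) i s ≡ η (M₁ ρ₁) i w) × (η (M₁ (σ₂ k)) i s ≡ η (M₁ ρ₂) i w)
    M-span-covers cover i w =
      let (k , s , hit) = M-covers (𝐉.span-covering R? closed cover) i w in
      k , s , project π₁ ⟨ σ₁ k , σ₂ k ⟩ ⟨ ρ₁ , ρ₂ ⟩ (π₁∘⟨,⟩ (σ₁ k) (σ₂ k)) (π₁∘⟨,⟩ ρ₁ ρ₂) hit ,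
              project π₂ ⟨ σ₁ k , σ₂ k ⟩ ⟨ ρ₁ , ρ₂ ⟩ (π₂∘⟨,⟩ (σ₁ k) (σ₂ k)) (π₂∘⟨,⟩ ρ₁ ρ₂) hit
      where
      open SpanCover cover
      project : ∀ {C S T : FinSetFunctor J} {σ : NatTrans S C} {ρ : NatTrans T C}
                (π : NatTrans Prod C) (h : NatTrans S Prod) (h′ : NatTrans T Prod) →
                π ∘ₙ h ≈ₙ σ → π ∘ₙ h′ ≈ₙ ρ → ∀ {s t} →
                η (M₁ h) i s ≡ η (M₁ h′) i t → η (M₁ σ) i s ≡ η (M₁ ρ) i t
      project {σ = σ} {ρ} π h h′ π∘h≈σ π∘h′≈ρ {s} {t} eq = begin
        η (M₁ σ) i s                ≡⟨ F-resp-≈ π∘h≈σ i s ⟨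
        η (M₁ (π ∘ₙ h)) i s         ≡⟨ F-∘ π h i s ⟩
        η (M₁ π) i (η (M₁ h) i s)   ≡⟨ cong (η (M₁ π) i) eq ⟩
        η (M₁ π) i (η (M₁ h′) i t)  ≡⟨ F-∘ π h′ i t ⟨
        η (M₁ (π ∘ₙ h′)) i t        ≡⟨ F-resp-≈ π∘h′≈ρ i t ⟩
        η (M₁ ρ) i t                ∎
        where open ≡-Reasoning

  module _ {D : FinCat} (F : Functor (FC D) SetF[ J ]) where
    open FinCat D using () renaming (nObj to nD; nHom to hD)
    open Functor F using (F₀; F₁)
    open Zigzags F

    module ZigzagRelation (n : ℕ) (a c : Fin nD) =
      𝐉.Relation (F₀ a) (F₀ c) (Zigzag n a c) (zigzag? n a c) (zigzag-closed n)

    step-cover : ∀ a c → SpanCover (F₀ a) (F₀ c) (Zigzag 0 a c)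
    step-cover a c = record
      { Index = Fin (hD a c) ⊎ Fin (hD c a)
      ; index-finite = finite-⊎ (finite-Fin _) (finite-Fin _)
      ; Source = Source
      ; σ₁ = σ₁
      ; σ₂ = σ₂
      ; sound = λ { (inj₁ f) j s → inj₁ (f , refl) ; (inj₂ g) j s → inj₂ (g , refl) }
      ; complete = λ { j x y (inj₁ (f , eq)) → inj₁ f , x , refl , eq
                     ; j x y (inj₂ (g , eq)) → inj₂ g , y , sym eq , refl }
      }
      where
      Source : Fin (hD a c) ⊎ Fin (hD c a) → FinSetFunctor J
      Source (inj₁ _) = F₀ a
      Source (inj₂ _) = F₀ c
      σ₁ : ∀ e → NatTrans (Source e) (F₀ a)
      σ₁ (inj₁ _) = idₙ
      σ₁ (inj₂ g) = F₁ g
      σ₂ : ∀ e → NatTrans (Source e) (F₀ c)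
      σ₂ (inj₁ f) = F₁ f
      σ₂ (inj₂ _) = idₙ

    Meets : ∀ n a b c j → Fin (S₀ (ZigzagRelation.Rel n a b) j) →
            Fin (S₀ (ZigzagRelation.Rel 0 b c) j) → Set
    Meets n a b c j w w′ = η (ZigzagRelation.ρ₂ n a b) j w ≡ η (ZigzagRelation.ρ₁ 0 b c) j w′

    meets-closed : ∀ n a b c {j k} (f : Fin (FinCat.nHom J j k)) w w′ → Meets n a b c j w w′ →
                   Meets n a b c k (S₁ (ZigzagRelation.Rel n a b) f w)
                                   (S₁ (ZigzagRelation.Rel 0 b c) f w′)
    meets-closed n a b c f w w′ eq =
      trans (natural (ZigzagRelation.ρ₂ n a b) f w)
            (trans (cong (S₁ (F₀ b) f) eq) (sym (natural (ZigzagRelation.ρ₁ 0 b c) f w′)))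

    module Composable (n : ℕ) (a b c : Fin nD) where
      module L = ZigzagRelation n a b
      module S = ZigzagRelation 0 b c
      open 𝐉.Relation L.Rel S.Rel (Meets n a b c) (λ j w w′ → _ ≟ _) (meets-closed n a b c) public

      τ₁ : NatTrans Rel (F₀ a)
      τ₁ = L.ρ₁ ∘ₙ ρ₁

      τ₂ : NatTrans Rel (F₀ c)
      τ₂ = S.ρ₂ ∘ₙ ρ₂

      composite : ∀ j w → Zigzag (suc n) a c j (η τ₁ j w) (η τ₂ j w)
      composite j w = b , _ , L.related j _ ,
        subst (λ y → Step b c j y (η τ₂ j w)) (sym (related j w)) (S.related j _)

      decompose : ∀ j x y z → Zigzag n a b j x y → Step b c j y z →
                  Σ (Fin (S₀ Rel j)) λ w → (η τ₁ j w ≡ x) × (η τ₂ j w ≡ z)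
      decompose j x y z r s =
        element j (L.element j x y r) (S.element j y z s) meet ,
        trans (cong (η L.ρ₁ j) (ρ₁-element j _ _ meet)) (L.ρ₁-element j x y r) ,
        trans (cong (η S.ρ₂ j) (ρ₂-element j _ _ meet)) (S.ρ₂-element j y z s)
        where meet = trans (L.ρ₂-element j x y r) (sym (S.ρ₁-element j y z s))

    composite-cover : ∀ n a c → SpanCover (F₀ a) (F₀ c) (Zigzag (suc n) a c)
    composite-cover n a c = record
      { Index = Fin nD
      ; index-finite = finite-Fin nD
      ; Source = λ b → Composable.Rel n a b c
      ; σ₁ = λ b → Composable.τ₁ n a b c
      ; σ₂ = λ b → Composable.τ₂ n a b c
      ; sound = λ b → Composable.composite n a b c
      ; complete = λ { j x z (b , y , r , s) → b , Composable.decompose n a b c j x y z r s }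
      }

    module _ (K′ : Cocone (M ∘F F)) where
      open Cocone K′ using (cocommute) renaming (coleg to κ)

      Respects : ∀ {a c} {S : FinSetFunctor J} → NatTrans S (F₀ a) → NatTrans S (F₀ c) → Set
      Respects {a} {c} σ₁ σ₂ = ∀ i w → η (κ a) i (η (M₁ σ₁) i w) ≡ η (κ c) i (η (M₁ σ₂) i w)

      graph-respects : ∀ {a c} (f : Fin (hD a c)) → Respects idₙ (F₁ f)
      graph-respects f i w = trans (cong (η (κ _) i) (F-id i w)) (sym (cocommute f i w))

      cograph-respects : ∀ {a c} (g : Fin (hD c a)) → Respects (F₁ g) idₙ
      cograph-respects g i w = trans (cocommute g i w) (sym (cong (η (κ _) i) (F-id i w)))

      respects-∘ : ∀ {a b c} {S T P : FinSetFunctor J}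
                     {ρ₁ : NatTrans S (F₀ a)} {ρ₂ : NatTrans S (F₀ b)}
                     {τ₁ : NatTrans T (F₀ b)} {τ₂ : NatTrans T (F₀ c)}
                   (σ : NatTrans P S) (σ′ : NatTrans P T) →
                   Respects ρ₁ ρ₂ → Respects τ₁ τ₂ → ρ₂ ∘ₙ σ ≈ₙ τ₁ ∘ₙ σ′ →
                   Respects (ρ₁ ∘ₙ σ) (τ₂ ∘ₙ σ′)
      respects-∘ {a} {b} {c} {ρ₁ = ρ₁} {ρ₂} {τ₁} {τ₂} σ σ′ ρ-respects τ-respects meet i w = begin
        η (κ a) i (η (M₁ (ρ₁ ∘ₙ σ)) i w)          ≡⟨ cong (η (κ a) i) (F-∘ ρ₁ σ i w) ⟩
        η (κ a) i (η (M₁ ρ₁) i (η (M₁ σ) i w))    ≡⟨ ρ-respects i _ ⟩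
        η (κ b) i (η (M₁ ρ₂) i (η (M₁ σ) i w))    ≡⟨ cong (η (κ b) i) (F-∘ ρ₂ σ i w) ⟨
        η (κ b) i (η (M₁ (ρ₂ ∘ₙ σ)) i w)          ≡⟨ cong (η (κ b) i) (F-resp-≈ meet i w) ⟩
        η (κ b) i (η (M₁ (τ₁ ∘ₙ σ′)) i w)         ≡⟨ cong (η (κ b) i) (F-∘ τ₁ σ′ i w) ⟩
        η (κ b) i (η (M₁ τ₁) i (η (M₁ σ′) i w))   ≡⟨ τ-respects i _ ⟩
        η (κ c) i (η (M₁ τ₂) i (η (M₁ σ′) i w))   ≡⟨ cong (η (κ c) i) (F-∘ τ₂ σ′ i w) ⟨
        η (κ c) i (η (M₁ (τ₂ ∘ₙ σ′)) i w)         ∎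
        where open ≡-Reasoning

      respects-cover : ∀ {a c} {R : ∀ j → Fin (S₀ (F₀ a) j) → Fin (S₀ (F₀ c) j) → Set}
                       (R? : ∀ j x y → Dec (R j x y))
                       (closed : ∀ {j k} (f : Fin (FinCat.nHom J j k)) x y →
                                 R j x y → R k (S₁ (F₀ a) f x) (S₁ (F₀ c) f y))
                       (cover : SpanCover (F₀ a) (F₀ c) R) →
                       (∀ k → Respects (SpanCover.σ₁ cover k) (SpanCover.σ₂ cover k)) →
                       Respects (𝐉.Relation.ρ₁ (F₀ a) (F₀ c) R R? closed)
                                (𝐉.Relation.ρ₂ (F₀ a) (F₀ c) R R? closed)
      respects-cover R? closed cover respects i w =
        let (k , s , eq₁ , eq₂) = M-span-covers R? closed cover i w in
        trans (cong (η (κ _) i) (sym eq₁)) (trans (respects k i s) (cong (η (κ _) i) eq₂))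

      zigzag-respects : ∀ n a c → Respects (ZigzagRelation.ρ₁ n a c) (ZigzagRelation.ρ₂ n a c)
      zigzag-respects zero a c = respects-cover (zigzag? 0 a c) (zigzag-closed 0) (step-cover a c)
        λ { (inj₁ f) → graph-respects f ; (inj₂ g) → cograph-respects g }
      zigzag-respects (suc n) a c =
        respects-cover (zigzag? (suc n) a c) (zigzag-closed (suc n)) (composite-cover n a c) λ b →
          respects-∘ (Composable.ρ₁ n a b c) (Composable.ρ₂ n a b c)
                     (zigzag-respects n a b) (zigzag-respects 0 b c) (Composable.related n a b c)

    module _ (K : Cocone F) (colimit : IsColimit K) where
      open Cocone K using (coleg)
      open Colimit K colimit

      M-jointly-surjective : 𝐈.Covers (Cocone.coleg (mapCocone M K)) 𝐈.idₙ
      M-jointly-surjective i y =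
        let (a , x , hit) = M-covers legs i y in a , x , trans hit (F-id i y)
        where
        legs : Covering (idₙ {Cocone.coapex K})
        legs = record
          { Index = Fin nD
          ; index-finite = finite-Fin nD
          ; Source = F₀
          ; part = coleg
          ; u-injective = λ j eq → eq
          ; within = λ a j x → η (coleg a) j x , refl
          ; covers = colimit-covers
          }

      M-kernel : ∀ (K′ : Cocone (M ∘F F)) {a b i x y} →
                 η (M₁ (coleg a)) i x ≡ η (M₁ (coleg b)) i y →
                 η (Cocone.coleg K′ a) i x ≡ η (Cocone.coleg K′ b) i y
      M-kernel K′ {a} {b} {i} {x} {y} eq =
        let (w , w₁ , w₂) = Cospan.pullback-surjective
                              (M ∘F Cospan.diagram SetF[ J ] (coleg a) (coleg b)) (mapCone M cone)
                              (preserves-limits Cospan.cospan _ cone isPullback) i x y eq in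
        trans (cong (η (Cocone.coleg K′ a) i) (sym w₁))
              (trans (zigzag-respects K′ bound a b i w) (cong (η (Cocone.coleg K′ b) i) w₂))
        where open KernelPair a b

lemma2p10 : (I J : FinCat) (M : Functor SetF[ J ] SetF[ I ]) →
            IsCoherent M → PreservesFiniteColimits M
lemma2p10 I J M coherent D F K colimit =
  FinSetFunctors.jointly-surjective⇒colimit I (mapCocone M K)
    (M-jointly-surjective F K colimit)
    (λ K′ → M-kernel F K colimit K′)
  where open Coherent M coherent
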